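{- Let $T$ be a finite rooted tree with $e$ edges. For each node $v$ of $T$, let $m(v)$ be the length (number of edges) of a shortest downward path from $v$ to a leaf if $v$ has at least $2$ children, and $m(v)=0$ otherwise. Then $\sum_{v\in V(T)} m(v)\le e$, where $V(T)$ is the set of nodes of $T$. -}

module Defs where

open import Data.Nat using (ℕ; zero; suc; _+_; _⊓_)
open import Data.List using (List; []; _∷_; length)

data Tree : Set where
  node : List Tree → Tree

-- number of edges: every edge joins a node to one of its children
mutual
  edges : Tree → ℕ
  edges (node cs) = length cs + edgesL cs

  edgesL : List Tree → ℕ
  edgesL []       = 0
  edgesL (c ∷ cs) = edges c + edgesL cs

mutual
  leafDist : Tree → ℕ
  leafDist (node [])       = 0
  leafDist (node (c ∷ cs)) = suc (minDist c cs)

  minDist : Tree → List Tree → ℕ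
  minDist c []        = leafDist c
  minDist c (d ∷ ds)  = leafDist c ⊓ minDist d ds

m : Tree → ℕ
m (node [])               = 0
m (node (_ ∷ []))         = 0
m t@(node (_ ∷ _ ∷ _))    = leafDist t

mutual
  sumM : Tree → ℕ
  sumM t@(node cs) = m t + sumML cs

  sumML : List Tree → ℕ
  sumML []       = 0
  sumML (c ∷ cs) = sumM c + sumML cs

-- Strengthen the claim to leafDist T + Σ m ≤ e and induct on T. At a node v with children
-- c₁ … c_k it suffices that leafDist v + m v ≤ k + Σᵢ leafDist cᵢ: for k ≤ 1 this is immediate,
-- and for k ≥ 2 both copies of leafDist v = 1 + minᵢ leafDist cᵢ are paid for by two distinct
-- children, one edge and one leafDist each.
module Submission where

open import Data.Nat using (ℕ; suc; _+_; _≤_; z≤n; s≤s)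
open import Data.Nat.Properties
  using (≤-refl; ≤-trans; +-assoc; +-suc; +-mono-≤; +-monoʳ-≤; +-monoˡ-≤;
         m≤m+n; m≤n+m; m⊓n≤m; m⊓n≤n; +-commutativeSemigroup; module ≤-Reasoning)
open import Algebra.Properties.CommutativeSemigroup +-commutativeSemigroup using (interchange)
open import Data.List using (List; []; _∷_; length)
open import Relation.Binary.PropositionalEquality using (cong; sym)

open import Defs

sumLeafDist : List Tree → ℕ
sumLeafDist []       = 0
sumLeafDist (c ∷ cs) = leafDist c + sumLeafDist cs

minDist≤leafDist : ∀ c ds → minDist c ds ≤ leafDist c
minDist≤leafDist c []       = ≤-refl
minDist≤leafDist c (d ∷ ds) = m⊓n≤m _ _

minDist+minDist≤sumLeafDist : ∀ c d ds →
  minDist c (d ∷ ds) + minDist c (d ∷ ds) ≤ sumLeafDist (c ∷ d ∷ ds)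
minDist+minDist≤sumLeafDist c d ds = begin
  minDist c (d ∷ ds) + minDist c (d ∷ ds)
    ≤⟨ +-mono-≤ (m⊓n≤m _ _) (≤-trans (m⊓n≤n _ _) (minDist≤leafDist d ds)) ⟩
  leafDist c + leafDist d
    ≤⟨ +-monoʳ-≤ (leafDist c) (m≤m+n _ _) ⟩
  sumLeafDist (c ∷ d ∷ ds) ∎
  where open ≤-Reasoning

leafDist+m≤length+sumLeafDist : ∀ cs →
  leafDist (node cs) + m (node cs) ≤ length cs + sumLeafDist cs
leafDist+m≤length+sumLeafDist []           = z≤n
leafDist+m≤length+sumLeafDist (c ∷ [])     = ≤-refl
leafDist+m≤length+sumLeafDist (c ∷ d ∷ ds) = begin
  suc a + suc a          ≡⟨ cong suc (+-suc a a) ⟩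
  suc (suc (a + a))      ≤⟨ s≤s (s≤s (minDist+minDist≤sumLeafDist c d ds)) ⟩
  suc (suc s)            ≤⟨ s≤s (s≤s (m≤n+m s (length ds))) ⟩
  suc (suc (length ds)) + s ∎
  where
  open ≤-Reasoning
  a = minDist c (d ∷ ds)
  s = sumLeafDist (c ∷ d ∷ ds)

mutual
  leafDist+sumM≤edges : ∀ t → leafDist t + sumM t ≤ edges t
  leafDist+sumM≤edges t@(node cs) = begin
    leafDist t + (m t + sumML cs)               ≡⟨ sym (+-assoc (leafDist t) (m t) _) ⟩
    leafDist t + m t + sumML cs                 ≤⟨ +-monoˡ-≤ (sumML cs) (leafDist+m≤length+sumLeafDist cs) ⟩
    length cs + sumLeafDist cs + sumML cs       ≡⟨ +-assoc (length cs) (sumLeafDist cs) _ ⟩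
    length cs + (sumLeafDist cs + sumML cs)     ≤⟨ +-monoʳ-≤ (length cs) (sumLeafDist+sumML≤edgesL cs) ⟩
    length cs + edgesL cs                       ∎
    where open ≤-Reasoning

  sumLeafDist+sumML≤edgesL : ∀ cs → sumLeafDist cs + sumML cs ≤ edgesL cs
  sumLeafDist+sumML≤edgesL []       = z≤n
  sumLeafDist+sumML≤edgesL (c ∷ cs) = begin
    leafDist c + sumLeafDist cs + (sumM c + sumML cs)     ≡⟨ interchange (leafDist c) (sumLeafDist cs) (sumM c) (sumML cs) ⟩
    (leafDist c + sumM c) + (sumLeafDist cs + sumML cs)   ≤⟨ +-mono-≤ (leafDist+sumM≤edges c) (sumLeafDist+sumML≤edgesL cs) ⟩
    edges c + edgesL cs                                   ∎
    where open ≤-Reasoning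

mainTheorem1 : (T : Tree) → sumM T ≤ edges T
mainTheorem1 T = ≤-trans (m≤n+m (sumM T) (leafDist T)) (leafDist+sumM≤edges T)
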